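{- For every integer $k\ge 0$, $f(k)\le 2^{2^k-k+1}-2$.
   Context: $\mu$ is the morphism on binary words with $\mu(0)=01$, $\mu(1)=10$; $\mu^n$ is its $n$-fold iterate. Words $CS(k)$, $k\ge 0$, are defined recursively: $CS(0)=0$ (the one-letter word). For $k\ge 1$, let $n=2^k$, $m=2^{k-1}$, $X=\mu^n(0)$, $Y=\mu^n(1)$, and write $X=x_0x_1\cdots x_{2^m-1}$, $Y=y_0y_1\cdots y_{2^m-1}$ as concatenations of $2^m$ consecutive blocks of length $2^m$ (each block is $\mu^m(0)$ or $\mu^m(1)$). For $0\le i<2^m-1$ define $cs_i=x_i$ if $i$ is even; if $i$ is odd, $cs_i=x_i$ when $x_i=y_{i+1}$ and $cs_i=CS(k-1)$ otherwise. Then $CS(k)=cs_0cs_1\cdots cs_{2^m-2}$ (a common subsequence of $\mu^{2^k}(0)$ and $\mu^{2^k}(1)$). Define $f(k)=2^{2^k}-|CS(k)|$. -}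

module Defs where

open import Data.Bool using (Bool; true; false; if_then_else_)
open import Data.Bool.Properties renaming (_≟_ to _≟ᵇ_)
open import Data.Nat using (ℕ; zero; suc; _+_; _*_; _∸_; _^_; _%_)
open import Data.List using (List; []; _∷_; concatMap; concat; map; take; drop; upTo; length; [_])
open import Data.List.Properties using (≡-dec)
open import Data.Integer using (ℤ; +_; _-_)
open import Relation.Nullary using (yes; no)
open import Function using (_∘_)

-- Binary words; the letter 0 is `false`, the letter 1 is `true`.
Word : Set
Word = List Bool

μ₁ : Bool → Word
μ₁ false = false ∷ true ∷ []
μ₁ true  = true ∷ false ∷ []

μ : Word → Word
μ = concatMap μ₁

μ^ : ℕ → Word → Word
μ^ zero    w = w
μ^ (suc n) w = μ (μ^ n w)

block : ℕ → ℕ → Word → Word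
block s i w = take s (drop (i * s) w)

CS : ℕ → Word
CS zero = [ false ]
CS (suc k) = concat (map cs (upTo (2 ^ m ∸ 1)))
  where
  n = 2 ^ suc k
  m = 2 ^ k          -- m = 2^((k+1)-1)
  X = μ^ n [ false ]
  Y = μ^ n [ true ]
  x : ℕ → Word
  x i = block (2 ^ m) i X
  y : ℕ → Word
  y i = block (2 ^ m) i Y
  cs : ℕ → Word
  cs i with i % 2
  ... | zero = x i
  ... | suc _ with ≡-dec _≟ᵇ_ (x i) (y (suc i))
  ...   | yes _ = x i
  ...   | no  _ = CS k

f : ℕ → ℤ
f k = + (2 ^ (2 ^ k)) - + length (CS k)

module Submission where

-- Write M(k) = 2^(2^k) = |μ^(2^k)(0)| and L(k) = |CS(k)|, and call
-- gap(k) = M(k) ∸ L(k) the number of letters CS(k) misses.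
--
-- 1. Lengths: |μ^n(w)| = 2^n |w|, so μ^(2^(k+1))(b) has length M(k)², and
--    each of its first M(k) blocks of length M(k) is complete.
-- 2. CS(k+1) is the concatenation of the pieces cs_0 … cs_(M(k)-2).  An even
--    piece is a block x_i of length M(k); an odd piece is x_i or CS(k), so has
--    length at least M(k) ⊓ L(k).  Writing M(k) = 2(h+1), there are h+1 even
--    and h odd pieces, hence L(k+1) ≥ (h+1)·M(k) + h·(M(k) ⊓ L(k)).
-- 3. Since M(k+1) = M(k)², this becomes gap(k+1) ≤ M(k) + h·gap(k).
-- 4. Induction on k with P(k) = 2^(2^k - k) gives gap(k) + 2 ≤ 2·P(k): the
--    recurrence sends the bound 2·P(k) to M(k)·P(k) = 2·P(k+1), using P(k) ≥ 2.
-- 5. Finally f(k) = M(k) - L(k) ≤ gap(k) ≤ 2^(2^k - k + 1) - 2 in ℤ.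

open import Defs
open import Data.Bool using (true; false)
open import Data.List using (List; []; _∷_; _++_; concat; map; take; drop; upTo; applyUpTo; length; [_])
open import Data.List.Properties using (length-++; length-take; length-drop; map-applyUpTo; ≡-dec)
open import Data.Bool.Properties using () renaming (_≟_ to _≟ᵇ_)
open import Data.Nat using (ℕ; zero; suc; pred; _+_; _*_; _∸_; _^_; _%_; _⊓_; _≤_; _<_; _≤?_; z≤n; s≤s)
open import Data.Nat.Properties
open import Data.Nat.DivMod using (m*n%n≡0)
open import Data.Nat.Tactic.RingSolver using (solve-∀)
open import Data.Integer as ℤ using (_-_)
import Data.Integer.Properties as ℤP
open import Data.Product using (Σ; _,_; proj₁; proj₂)
open import Data.Sum using (_⊎_; inj₁; inj₂)
open import Relation.Nullary using (yes; no)
open import Relation.Binary.PropositionalEquality using (_≡_; refl; sym; trans; cong; subst; subst₂)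

open ≤-Reasoning

length-μ : ∀ w → length (μ w) ≡ 2 * length w
length-μ []          = refl
length-μ (false ∷ w) = trans (cong (2 +_) (length-μ w)) (sym (*-suc 2 (length w)))
length-μ (true ∷ w)  = trans (cong (2 +_) (length-μ w)) (sym (*-suc 2 (length w)))

length-μ^ : ∀ n w → length (μ^ n w) ≡ 2 ^ n * length w
length-μ^ zero    w = sym (*-identityˡ (length w))
length-μ^ (suc n) w = begin-equality
  length (μ (μ^ n w))      ≡⟨ length-μ (μ^ n w) ⟩
  2 * length (μ^ n w)      ≡⟨ cong (2 *_) (length-μ^ n w) ⟩
  2 * (2 ^ n * length w)   ≡⟨ *-assoc 2 (2 ^ n) (length w) ⟨
  2 ^ suc n * length w     ∎

length-block : ∀ s i w → suc i * s ≤ length w → length (block s i w) ≡ s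
length-block s i w fits = begin-equality
  length (take s (drop (i * s) w))  ≡⟨ length-take s (drop (i * s) w) ⟩
  s ⊓ length (drop (i * s) w)       ≡⟨ cong (s ⊓_) (length-drop (i * s) w) ⟩
  s ⊓ (length w ∸ i * s)            ≡⟨ m≤n⇒m⊓n≡m (m+n≤o⇒m≤o∸n s fits) ⟩
  s                                 ∎

M : ℕ → ℕ
M k = 2 ^ 2 ^ k

-- 2^(2^(k+1)) = (2^(2^k))², which makes the block grid of CS(k+1) square.
M-suc : ∀ k → M (suc k) ≡ M k * M k
M-suc k = trans (cong (2 ^_) (cong (2 ^ k +_) (+-identityʳ (2 ^ k))))
                (^-distribˡ-+-* 2 (2 ^ k) (2 ^ k))

M-even : ∀ k → Σ ℕ λ h → M k ≡ 2 * suc h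
M-even k = even (2 ^ k) (m^n>0 2 k)
  where
  even : ∀ n → 0 < n → Σ ℕ λ h → 2 ^ n ≡ 2 * suc h
  even (suc n) _ = pred (2 ^ n) , cong (2 *_) (sym (suc-pred (2 ^ n) {{m^n≢0 2 n}}))

length-tm-block : ∀ k b i → i < M k → length (block (M k) i (μ^ (2 ^ suc k) [ b ])) ≡ M k
length-tm-block k b i i<M = length-block (M k) i (μ^ (2 ^ suc k) [ b ]) (begin
  suc i * M k                            ≤⟨ *-monoˡ-≤ (M k) i<M ⟩
  M k * M k                              ≡⟨ M-suc k ⟨
  M (suc k)                              ≡⟨ *-identityʳ (M (suc k)) ⟨
  2 ^ 2 ^ suc k * 1                      ≡⟨ length-μ^ (2 ^ suc k) [ b ] ⟨
  length (μ^ (2 ^ suc k) [ b ])          ∎)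

-- The pieces cs_i of CS(k+1).  The piece function is local to the definition
-- of CS, so it is named here as the function that CS(k+1) concatenates.

CS-pieces : ∀ k → Σ (ℕ → Word) λ cs → CS (suc k) ≡ concat (map cs (upTo (M k ∸ 1)))
CS-pieces k = _ , refl

piece : ℕ → ℕ → Word
piece k = proj₁ (CS-pieces k)

x-block : ℕ → ℕ → Word
x-block k i = block (M k) i (μ^ (2 ^ suc k) [ false ])

piece-even : ∀ k i → i % 2 ≡ 0 → piece k i ≡ x-block k i
piece-even k i i-even with i % 2
piece-even k i refl | .0 = refl

piece-cases : ∀ k i → piece k i ≡ x-block k i ⊎ piece k i ≡ CS k
piece-cases k i with i % 2
... | zero  = inj₁ refl
... | suc _ with ≡-dec _≟ᵇ_ (x-block k i) (block (M k) (suc i) (μ^ (2 ^ suc k) [ true ]))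
...   | yes _ = inj₁ refl
...   | no  _ = inj₂ refl

L : ℕ → ℕ
L k = length (CS k)

length-even-piece : ∀ k t → 2 * t < M k → M k ≤ length (piece k (2 * t))
length-even-piece k t 2t<M = ≤-reflexive (begin-equality
  M k                          ≡⟨ length-tm-block k false (2 * t) 2t<M ⟨
  length (x-block k (2 * t))   ≡⟨ cong length (piece-even k (2 * t) 2t-even) ⟨
  length (piece k (2 * t))     ∎)
  where
  2t-even : (2 * t) % 2 ≡ 0
  2t-even = subst (λ n → n % 2 ≡ 0) (*-comm t 2) (m*n%n≡0 t 2)

length-piece : ∀ k i → i < M k → M k ⊓ L k ≤ length (piece k i)
length-piece k i i<M with piece-cases k i
... | inj₁ eq = subst (λ w → M k ⊓ L k ≤ length w) (sym eq)
                  (subst (M k ⊓ L k ≤_) (sym (length-tm-block k false i i<M)) (m⊓n≤m (M k) (L k)))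
... | inj₂ eq = subst (λ w → M k ⊓ L k ≤ length w) (sym eq) (m⊓n≤n (M k) (L k))

length-concat-alternating : ∀ {A : Set} (g : ℕ → List A) (a b h : ℕ)
  → (∀ t → t ≤ h → a ≤ length (g (2 * t)))
  → (∀ t → t < h → b ≤ length (g (suc (2 * t))))
  → suc h * a + h * b ≤ length (concat (applyUpTo g (suc (2 * h))))
length-concat-alternating g a b zero even odd = begin
  a + 0 + 0            ≡⟨ +-identityʳ (a + 0) ⟩
  a + 0                ≤⟨ +-monoˡ-≤ 0 (even 0 z≤n) ⟩
  length (g 0) + 0     ≡⟨ length-++ (g 0) ⟨
  length (g 0 ++ [])   ∎
length-concat-alternating {A} g a b (suc h) even odd = begin
  suc (suc h) * a + suc h * b
    ≡⟨ regroup a b h ⟩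
  a + (b + (suc h * a + h * b))
    ≤⟨ +-mono-≤ (even 0 z≤n) (+-mono-≤ (odd 0 (s≤s z≤n)) rest-bound) ⟩
  length (g 0) + (length (g 1) + length rest)
    ≡⟨ cong (length (g 0) +_) (length-++ (g 1)) ⟨
  length (g 0) + length (g 1 ++ rest)
    ≡⟨ length-++ (g 0) ⟨
  length (concat (applyUpTo g (suc (suc (suc (2 * h))))))
    ≡⟨ cong (λ n → length (concat (applyUpTo g (suc n)))) (*-suc 2 h) ⟨
  length (concat (applyUpTo g (suc (2 * suc h))))
    ∎
  where
  regroup : ∀ a b h → suc (suc h) * a + suc h * b ≡ a + (b + (suc h * a + h * b))
  regroup = solve-∀
  shifted : ℕ → List A
  shifted i = g (suc (suc i))
  rest : List A
  rest = concat (applyUpTo shifted (suc (2 * h)))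
  rest-bound : suc h * a + h * b ≤ length rest
  rest-bound = length-concat-alternating shifted a b h
    (λ t t≤h → subst (λ n → a ≤ length (g n)) (*-suc 2 t) (even (suc t) (s≤s t≤h)))
    (λ t t<h → subst (λ n → b ≤ length (g (suc n))) (*-suc 2 t) (odd (suc t) (s≤s t<h)))

length-CS-suc : ∀ k h → M k ≡ 2 * suc h → suc h * M k + h * (M k ⊓ L k) ≤ L (suc k)
length-CS-suc k h M≡ = begin
  suc h * M k + h * (M k ⊓ L k)
    ≤⟨ length-concat-alternating (piece k) (M k) (M k ⊓ L k) h even-bound odd-bound ⟩
  length (concat (applyUpTo (piece k) (suc (2 * h))))
    ≡⟨ cong (λ n → length (concat (applyUpTo (piece k) n))) piece-count ⟨
  length (concat (applyUpTo (piece k) (M k ∸ 1)))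
    ≡⟨ cong (λ ws → length (concat ws)) (map-applyUpTo (λ i → i) (piece k) (M k ∸ 1)) ⟨
  length (concat (map (piece k) (upTo (M k ∸ 1))))
    ≡⟨ cong length (proj₂ (CS-pieces k)) ⟨
  L (suc k)
    ∎
  where
  piece-count : M k ∸ 1 ≡ suc (2 * h)
  piece-count = trans (cong (_∸ 1) M≡) (+-suc h (h + 0))
  even-bound : ∀ t → t ≤ h → M k ≤ length (piece k (2 * t))
  even-bound t t≤h = length-even-piece k t
    (subst (2 * t <_) (sym M≡) (*-monoʳ-< 2 (s≤s t≤h)))
  odd-bound : ∀ t → t < h → M k ⊓ L k ≤ length (piece k (suc (2 * t)))
  odd-bound t t<h = length-piece k (suc (2 * t))
    (subst₂ _≤_ (*-suc 2 t) (sym M≡) (*-monoʳ-≤ 2 (s≤s (<⇒≤ t<h))))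

gap : ℕ → ℕ
gap k = M k ∸ L k

gap-suc : ∀ k h → M k ≡ 2 * suc h → gap (suc k) ≤ M k + h * gap k
gap-suc k h M≡ = m≤n+o⇒m∸n≤o (M (suc k)) (L (suc k)) (begin
  M (suc k)                                   ≡⟨ M-suc k ⟩
  M k * M k                                   ≡⟨ cong (M k *_) M≡ ⟩
  M k * (2 * suc h)                           ≡⟨ split (M k) h ⟩
  suc h * M k + M k + h * M k                 ≡⟨ cong (λ n → suc h * M k + M k + h * n) covered+gap ⟨
  suc h * M k + M k + h * (covered + gap k)   ≡⟨ regroup (M k) h covered (gap k) ⟩
  (suc h * M k + h * covered) + (M k + h * gap k)
                                              ≤⟨ +-monoˡ-≤ (M k + h * gap k) (length-CS-suc k h M≡) ⟩
  L (suc k) + (M k + h * gap k)               ∎)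
  where
  covered : ℕ
  covered = M k ⊓ L k
  covered+gap : covered + gap k ≡ M k
  covered+gap = trans (cong (_+ gap k) (⊓-comm (M k) (L k))) (m⊓n+n∸m≡n (L k) (M k))
  split : ∀ m h → m * (2 * suc h) ≡ suc h * m + m + h * m
  split = solve-∀
  regroup : ∀ m h c g → suc h * m + m + h * (c + g) ≡ (suc h * m + h * c) + (m + h * g)
  regroup = solve-∀

recurrence-preserves-bound : ∀ h {g g′ P} → g′ ≤ 2 * suc h + h * g → g + 2 ≤ 2 * P → 2 ≤ P
  → g′ + 2 ≤ 2 * suc h * P
recurrence-preserves-bound h {g} {g′} {P} step bound 2≤P = begin
  g′ + 2                    ≤⟨ +-monoˡ-≤ 2 step ⟩
  2 * suc h + h * g + 2     ≡⟨ regroup h g ⟩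
  h * (g + 2) + 2 * 2       ≤⟨ +-mono-≤ (*-monoʳ-≤ h bound) (*-monoʳ-≤ 2 2≤P) ⟩
  h * (2 * P) + 2 * P       ≡⟨ collect h P ⟩
  2 * suc h * P             ∎
  where
  regroup : ∀ h g → 2 * suc h + h * g + 2 ≡ h * (g + 2) + 2 * 2
  regroup = solve-∀
  collect : ∀ h P → h * (2 * P) + 2 * P ≡ 2 * suc h * P
  collect = solve-∀

-- k < 2^k, so that 2^k - k is a positive exponent.
k<2^k : ∀ k → k < 2 ^ k
k<2^k zero    = s≤s z≤n
k<2^k (suc k) = begin-strict
  suc k            <⟨ +-mono-≤ (m^n>0 2 k) (k<2^k k) ⟩
  2 ^ k + 2 ^ k    ≡⟨ cong (2 ^ k +_) (+-identityʳ (2 ^ k)) ⟨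
  2 ^ suc k        ∎

-- P k = 2^(2^k - k), half of the bound to be proved at level k.
P : ℕ → ℕ
P k = 2 ^ (2 ^ k ∸ k)

2≤P : ∀ k → 2 ≤ P k
2≤P k = ^-monoʳ-≤ 2 (m<n⇒0<n∸m (k<2^k k))

bound≡2P : ∀ k → 2 ^ (2 ^ k ∸ k + 1) ≡ 2 * P k
bound≡2P k = trans (^-distribˡ-+-* 2 (2 ^ k ∸ k) 1) (*-comm (P k) 2)

bound-suc≡MP : ∀ k → 2 ^ (2 ^ suc k ∸ suc k + 1) ≡ M k * P k
bound-suc≡MP k = trans (cong (2 ^_) exponent) (^-distribˡ-+-* 2 a (a ∸ k))
  where
  a : ℕ
  a = 2 ^ k
  exponent : 2 ^ suc k ∸ suc k + 1 ≡ a + (a ∸ k)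
  exponent = begin-equality
    a + (a + 0) ∸ suc k + 1   ≡⟨ cong (λ n → a + n ∸ suc k + 1) (+-identityʳ a) ⟩
    a + a ∸ suc k + 1         ≡⟨ cong (_+ 1) (+-∸-assoc a (k<2^k k)) ⟩
    a + (a ∸ suc k) + 1       ≡⟨ +-assoc a (a ∸ suc k) 1 ⟩
    a + (a ∸ suc k + 1)       ≡⟨ cong (a +_) (+-comm (a ∸ suc k) 1) ⟩
    a + suc (a ∸ suc k)       ≡⟨ cong (a +_) (+-∸-assoc 1 (k<2^k k)) ⟨
    a + (a ∸ k)               ∎

gap-bound : ∀ k → gap k + 2 ≤ 2 ^ (2 ^ k ∸ k + 1)
gap-bound zero    = s≤s (s≤s (s≤s z≤n))
gap-bound (suc k) with M-even k
... | h , M≡ = begin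
  gap (suc k) + 2                   ≤⟨ recurrence-preserves-bound h step bound (2≤P k) ⟩
  2 * suc h * P k                   ≡⟨ cong (_* P k) M≡ ⟨
  M k * P k                         ≡⟨ bound-suc≡MP k ⟨
  2 ^ (2 ^ suc k ∸ suc k + 1)       ∎
  where
  step : gap (suc k) ≤ 2 * suc h + h * gap k
  step = subst (λ m → gap (suc k) ≤ m + h * gap k) M≡ (gap-suc k h M≡)
  bound : gap k + 2 ≤ 2 * P k
  bound = subst (gap k + 2 ≤_) (bound≡2P k) (gap-bound k)

m-n≤m∸n : ∀ m n → ℤ.+ m - ℤ.+ n ℤ.≤ ℤ.+ (m ∸ n)
m-n≤m∸n m n with n ≤? m
... | yes n≤m = ℤP.≤-reflexive (trans (ℤP.m-n≡m⊖n m n) (ℤP.⊖-≥ n≤m))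
... | no  n≰m = ℤP.≤-trans (ℤP.≤-reflexive (trans (ℤP.m-n≡m⊖n m n) (ℤP.⊖-≰ n≰m))) ℤP.neg-≤-pos

m∸n≡m-n : ∀ {m n} → n ≤ m → ℤ.+ (m ∸ n) ≡ ℤ.+ m - ℤ.+ n
m∸n≡m-n {m} {n} n≤m = sym (trans (ℤP.m-n≡m⊖n m n) (ℤP.⊖-≥ n≤m))

-- Step 5: f(k) ≤ gap(k) ≤ bound ∸ 2 = bound - 2, the last since bound ≥ gap(k) + 2 ≥ 2.
lemma2 : (k : ℕ) → f k ℤ.≤ ℤ.+ (2 ^ (2 ^ k ∸ k + 1)) - ℤ.+ 2
lemma2 k = ℤP.≤-trans (m-n≤m∸n (M k) (L k)) (ℤP.≤-trans
  (ℤ.+≤+ (m+n≤o⇒m≤o∸n (gap k) (gap-bound k)))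
  (ℤP.≤-reflexive (m∸n≡m-n (≤-trans (m≤n+m 2 (gap k)) (gap-bound k)))))
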